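{- If $b$ is a super-core of a function $f:\{0,1\}^n\to\{0,1\}^{m(n)}$, then $b$ is a hard-core of $f$.
   Context: A predicate $b:\{0,1\}^n\to\{0,1\}$ in $\mathsf{P}/\mathsf{poly}$ is a hard-core of $f$ if there do not exist $\mathcal{A}\in\mathsf{P}/\mathsf{poly}$, a polynomial $p$, and infinitely many $n$ with $\Pr_{x\in\{0,1\}^n}[\mathcal{A}(f(x),1^n)=b(x)]\ge 1/2+1/p(n)$. A predicate $b:\{0,1\}^n\to\{0,1\}$ in $\mathsf{P}/\mathsf{poly}$ is a super-core of $f$ if (a) there do not exist $\mathcal{A}_1\in\mathsf{NP}/\mathsf{poly}$, a polynomial $p$, and infinitely many $n$ with $\Pr_{x\in\{0,1\}^n}[\mathcal{A}_1(f(x),1^n)=b(x)=0]+\frac12\Pr_{y\in\{0,1\}^{m}}[\mathcal{A}_1(y,1^n)=1]\ge \frac12+\frac1{p(n)}$, and (b) there do not exist $\mathcal{A}_2\in\mathsf{coNP}/\mathsf{poly}$, a polynomial $p$, and infinitely many $n$ with $\Pr_{x\in\{0,1\}^n}[\mathcal{A}_2(f(x),1^n)=b(x)=1]+\frac12\Pr_{y\in\{0,1\}^{m}}[\mathcal{A}_2(y,1^n)=0]\ge \frac12+\frac1{p(n)}$. Probabilities are over uniform distributions. -}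

module Defs where

open import Data.Bool using (Bool; true; false; not; _∧_; _∨_; if_then_else_)
open import Data.Nat as ℕ using (ℕ; zero; suc; _^_)
open import Data.Nat.Properties using (m^n≢0)
open import Data.Fin using (Fin)
open import Data.Vec using (Vec; []; _∷_; _++_; replicate; lookup)
open import Data.List using (List; [_]; map)
open import Data.Nat.ListAction using (sum)
open import Data.Bool.ListAction using (any; all)
import Data.List as L
open import Data.Integer using (+_)
open import Data.Rational using (ℚ; _/_; 0ℚ; ½; _+_; _*_; _≤_)
open import Data.Product using (Σ; ∃; ∃-syntax; _×_)
open import Relation.Nullary using (¬_)
open import Relation.Binary.PropositionalEquality using () renaming (_≡_ to _≡′_)

Bits : ℕ → Set
Bits k = Vec Bool k

allBits : (k : ℕ) → List (Bits k)
allBits zero    = [ [] ]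
allBits (suc k) = L._++_ (map (true ∷_) (allBits k)) (map (false ∷_) (allBits k))

count : (k : ℕ) → (Bits k → Bool) → ℕ
count k P = sum (map (λ x → if P x then 1 else 0) (allBits k))

Pr : (k : ℕ) → (Bits k → Bool) → ℚ
Pr k P = (+ count k P) / (2 ^ k)
  where instance _ = m^n≢0 2 k

-- a / d as a rational; only used with d ≥ 1 (the d = 0 case is excluded
-- separately wherever this is used)
frac : ℕ → ℕ → ℚ
frac a zero    = 0ℚ
frac a (suc d) = (+ a) / suc d

ones : (n : ℕ) → Bits n
ones n = replicate n true

-- Polynomials (coefficient lists, lowest degree first, ℕ coefficients)

Poly : Set
Poly = List ℕ

evalPoly : Poly → ℕ → ℕ
evalPoly L.[]       n = 0
evalPoly (a L.∷ as) n = a ℕ.+ n ℕ.* evalPoly as n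

data Gate (w : ℕ) : Set where
  constG : Bool → Gate w
  notG   : Fin w → Gate w
  andG   : Fin w → Fin w → Gate w
  orG    : Fin w → Fin w → Gate w

evalGate : ∀ {w} → Vec Bool w → Gate w → Bool
evalGate v (constG c) = c
evalGate v (notG i)   = not (lookup v i)
evalGate v (andG i j) = lookup v i ∧ lookup v j
evalGate v (orG i j)  = lookup v i ∨ lookup v j

-- Circuit i s : a circuit with i inputs and s gates; each gate may read
-- any input or any earlier gate.
data Circuit (i : ℕ) : ℕ → Set where
  []  : Circuit i 0
  _▷_ : ∀ {s} → Circuit i s → Gate (s ℕ.+ i) → Circuit i (suc s)

wires : ∀ {i s} → Circuit i s → Bits i → Vec Bool (s ℕ.+ i)
wires []      x = x
wires (c ▷ g) x = evalGate (wires c x) g ∷ wires c x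

record OCircuit (i : ℕ) : Set where
  constructor mkOC
  field
    size : ℕ
    gates : Circuit i size
    out  : Fin (size ℕ.+ i)

runC : ∀ {i} → OCircuit i → Bits i → Bool
runC C x = lookup (wires (OCircuit.gates C) x) (OCircuit.out C)

record PPoly (inLen : ℕ → ℕ) : Set where
  field
    bound : Poly
    circ  : (n : ℕ) → OCircuit (inLen n)
    small : (n : ℕ) → OCircuit.size (circ n) ℕ.≤ evalPoly bound (inLen n)

runP : ∀ {ℓ} → PPoly ℓ → (n : ℕ) → Bits (ℓ n) → Bool
runP A n = runC (PPoly.circ A n)

-- NP/poly and coNP/poly : polynomial-size circuits with an extra
-- polynomial-length witness input.
record NPoly (inLen : ℕ → ℕ) : Set where
  field
    bound  : Poly
    witLen : ℕ → ℕ
    circ   : (n : ℕ) → OCircuit (inLen n ℕ.+ witLen n)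
    small  : (n : ℕ) → OCircuit.size (circ n) ℕ.≤ evalPoly bound (inLen n)
    wsmall : (n : ℕ) → witLen n ℕ.≤ evalPoly bound (inLen n)

runNP : ∀ {ℓ} → NPoly ℓ → (n : ℕ) → Bits (ℓ n) → Bool
runNP A n y = any (λ w → runC (NPoly.circ A n) (y ++ w)) (allBits (NPoly.witLen A n))

runCoNP : ∀ {ℓ} → NPoly ℓ → (n : ℕ) → Bits (ℓ n) → Bool
runCoNP A n y = all (λ w → runC (NPoly.circ A n) (y ++ w)) (allBits (NPoly.witLen A n))

InfinitelyMany : (ℕ → Set) → Set
InfinitelyMany P = ¬ (∃[ N ] ((n : ℕ) → N ℕ.≤ n → ¬ P n))

-- Setting: f_n : {0,1}^n → {0,1}^{m n}, b_n : {0,1}^n → {0,1}.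
-- The adversaries receive (f(x), 1^n), a string of length m n + n.

Fun : (ℕ → ℕ) → Set
Fun m = (n : ℕ) → Bits n → Bits (m n)

Pred : Set
Pred = (n : ℕ) → Bits n → Bool

beq : Bool → Bool → Bool
beq true  c = c
beq false c = not c

advLen : (ℕ → ℕ) → ℕ → ℕ
advLen m n = m n ℕ.+ n

InPPoly : Pred → Set
InPPoly b = Σ (PPoly (λ n → n)) λ B → (n : ℕ) (x : Bits n) → runP B n x ≡′ b n x

HardCore : (m : ℕ → ℕ) → Fun m → Pred → Set
HardCore m f b =
  InPPoly b ×
  ¬ (Σ (PPoly (advLen m)) λ A → ∃[ p ] InfinitelyMany λ n →
       (0 ℕ.< evalPoly p n) ×
       (½ + frac 1 (evalPoly p n) ≤
          Pr n (λ x → beq (runP A n (f n x ++ ones n)) (b n x))))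

SuperCore : (m : ℕ → ℕ) → Fun m → Pred → Set
SuperCore m f b =
  InPPoly b ×
  ¬ (Σ (NPoly (advLen m)) λ A₁ → ∃[ p ] InfinitelyMany λ n →
       (0 ℕ.< evalPoly p n) ×
       (½ + frac 1 (evalPoly p n) ≤
          Pr n (λ x → not (runNP A₁ n (f n x ++ ones n)) ∧ not (b n x))
          + ½ * Pr (m n) (λ y → runNP A₁ n (y ++ ones n)))) ×
  ¬ (Σ (NPoly (advLen m)) λ A₂ → ∃[ p ] InfinitelyMany λ n →
       (0 ℕ.< evalPoly p n) ×
       (½ + frac 1 (evalPoly p n) ≤
          Pr n (λ x → runCoNP A₂ n (f n x ++ ones n) ∧ b n x)
          + ½ * Pr (m n) (λ y → not (runCoNP A₂ n (y ++ ones n)))))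

{-# OPTIONS --safe #-}
-- A P/poly predictor A of b is also an NP/poly and a coNP/poly algorithm
-- (with empty witnesses).  For it, Pr[A(f x) = b x] = Pr[A = b = 0] + Pr[A = b = 1]
-- and Pr_y[A y = 1] + Pr_y[A y = 0] = 1, so the two super-core quantities of A
-- add up to Pr[A(f x) = b x] + 1/2.  Hence at every n where A has advantage 1/p,
-- A has advantage 1/(2p) in condition (a) or in condition (b); as the union of
-- two finite sets is finite, one of the two happens for infinitely many n.

module Submission where

open import Defs
open import Data.Nat as ℕ using (ℕ; zero; suc; _⊔_; z≤n)
import Data.Nat.Properties as ℕ
open import Data.Bool using (Bool; true; false; not; _∧_; _∨_; if_then_else_)
open import Data.Bool.Properties using (∨-identityʳ; ∧-identityʳ)
open import Data.Integer as ℤ using (+_)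
import Data.Integer.Properties as ℤ
open import Data.Rational using (ℚ; _/_; ½; _+_; _*_; _≤_; 1ℚ; toℚᵘ)
open import Data.Rational.Properties
import Data.Rational.Unnormalised as ℚᵘ
import Data.Rational.Unnormalised.Properties as ℚᵘ
open import Data.List as List using (List)
open import Data.List.Properties using (length-++; length-map; map-cong)
open import Data.Nat.ListAction using (sum)
open import Data.Vec using ([]; _∷_; _++_; cast)
open import Data.Vec.Properties using (cast-is-id; ++-identityʳ-eqFree)
open import Data.Product using (_,_; _×_)
open import Data.Sum as Sum using (_⊎_; inj₁; inj₂; [_,_])
open import Data.Empty using (⊥-elim)
open import Function using (_∘_)
open import Algebra.Properties.CommutativeSemigroup ℕ.+-commutativeSemigroup
  using () renaming (interchange to +-interchange)
open import Algebra.Properties.CommutativeSemigroup ℕ.*-commutativeSemigroup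
  using () renaming (x∙yz≈y∙xz to *-left-commute)
open import Relation.Binary.PropositionalEquality hiding ([_])
open import Relation.Nullary using (¬_; yes; no)

toℚᵘ-/ : ∀ i d → toℚᵘ (i / suc d) ℚᵘ.≃ ℚᵘ.mkℚᵘ i d
toℚᵘ-/ i d = toℚᵘ-fromℚᵘ (ℚᵘ.mkℚᵘ i d)

a/d+b/d≡[a+b]/d : ∀ a b d .{{_ : ℕ.NonZero d}} → (+ a) / d + (+ b) / d ≡ (+ (a ℕ.+ b)) / d
a/d+b/d≡[a+b]/d a b (suc d) = toℚᵘ-injective (begin-equality
  toℚᵘ ((+ a) / suc d + (+ b) / suc d)             ≃⟨ toℚᵘ-homo-+ ((+ a) / suc d) ((+ b) / suc d) ⟩
  toℚᵘ ((+ a) / suc d) ℚᵘ.+ toℚᵘ ((+ b) / suc d)   ≃⟨ ℚᵘ.+-cong (toℚᵘ-/ (+ a) d) (toℚᵘ-/ (+ b) d) ⟩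
  ℚᵘ.mkℚᵘ (+ a) d ℚᵘ.+ ℚᵘ.mkℚᵘ (+ b) d             ≃⟨ ℚᵘ.*≡* cross ⟩
  ℚᵘ.mkℚᵘ (+ (a ℕ.+ b)) d                          ≃⟨ toℚᵘ-/ (+ (a ℕ.+ b)) d ⟨
  toℚᵘ ((+ (a ℕ.+ b)) / suc d)                     ∎)
  where
  open ℚᵘ.≤-Reasoning
  open import Data.Integer.Solver using (module +-*-Solver)
  open +-*-Solver
  cross : ((+ a) ℤ.* + suc d ℤ.+ (+ b) ℤ.* + suc d) ℤ.* + suc d ≡ + (a ℕ.+ b) ℤ.* + (suc d ℕ.* suc d)
  cross = trans
    (solve 3 (λ a b D → (a :* D :+ b :* D) :* D := (a :+ b) :* (D :* D)) refl (+ a) (+ b) (+ suc d))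
    (cong₂ ℤ._*_ (sym (ℤ.pos-+ a b)) (sym (ℤ.pos-* (suc d) (suc d))))

d/d≡1 : ∀ d .{{_ : ℕ.NonZero d}} → (+ d) / d ≡ 1ℚ
d/d≡1 (suc d) = toℚᵘ-injective
  (ℚᵘ.≃-trans (toℚᵘ-/ (+ suc d) d) (ℚᵘ.*≡* (ℤ.*-comm (+ suc d) (+ 1))))

frac-1-* : ∀ a b → frac 1 (a ℕ.* b) ≡ frac 1 a * frac 1 b
frac-1-* zero    b       = sym (*-zeroˡ (frac 1 b))
frac-1-* (suc a) zero    = trans (cong (frac 1) (ℕ.*-zeroʳ a)) (sym (*-zeroʳ (frac 1 (suc a))))
frac-1-* (suc a) (suc b) = toℚᵘ-injective (begin-equality
  toℚᵘ ((+ 1) / (suc a ℕ.* suc b))                       ≃⟨ toℚᵘ-/ (+ 1) _ ⟩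
  ℚᵘ.mkℚᵘ (+ 1) (b ℕ.+ a ℕ.* suc b)                     ≃⟨ ℚᵘ.*≡* refl ⟩
  ℚᵘ.mkℚᵘ (+ 1) a ℚᵘ.* ℚᵘ.mkℚᵘ (+ 1) b                  ≃⟨ ℚᵘ.*-cong (toℚᵘ-/ (+ 1) a) (toℚᵘ-/ (+ 1) b) ⟨
  toℚᵘ ((+ 1) / suc a) ℚᵘ.* toℚᵘ ((+ 1) / suc b)         ≃⟨ toℚᵘ-homo-* ((+ 1) / suc a) ((+ 1) / suc b) ⟨
  toℚᵘ (((+ 1) / suc a) * ((+ 1) / suc b))               ∎)
  where open ℚᵘ.≤-Reasoning

c+c≤x+y⇒c≤x⊎c≤y : ∀ {c x y} → c + c ≤ x + y → c ≤ x ⊎ c ≤ y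
c+c≤x+y⇒c≤x⊎c≤y {c} {x} {y} c+c≤x+y with c ≤? x | c ≤? y
... | yes c≤x | _       = inj₁ c≤x
... | no _    | yes c≤y = inj₂ c≤y
... | no c≰x  | no c≰y  =
  ⊥-elim (<-irrefl refl (<-≤-trans (+-mono-< (≰⇒> c≰x) (≰⇒> c≰y)) c+c≤x+y))

½+e≤u+v⇒halves : ∀ u v s t e → s + t ≡ 1ℚ → ½ + e ≤ u + v →
                 ½ + ½ * e ≤ u + ½ * s ⊎ ½ + ½ * e ≤ v + ½ * t
½+e≤u+v⇒halves u v s t e s+t≡1 ½+e≤u+v = c+c≤x+y⇒c≤x⊎c≤y (begin
  (½ + ½ * e) + (½ + ½ * e)     ≡⟨ solve 1 (λ e → (con ½ :+ con ½ :* e) :+ (con ½ :+ con ½ :* e)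
                                                   := (con ½ :+ e) :+ con ½) refl e ⟩
  (½ + e) + ½                   ≤⟨ +-monoˡ-≤ ½ ½+e≤u+v ⟩
  (u + v) + ½                   ≡⟨ cong (λ z → (u + v) + z) (trans (sym (*-identityʳ ½)) (cong (½ *_) (sym s+t≡1))) ⟩
  (u + v) + ½ * (s + t)         ≡⟨ solve 4 (λ u v s t → (u :+ v) :+ con ½ :* (s :+ t)
                                                   := (u :+ con ½ :* s) :+ (v :+ con ½ :* t)) refl u v s t ⟩
  (u + ½ * s) + (v + ½ * t)     ∎)
  where
  open ≤-Reasoning
  open import Data.Rational.Solver using (module +-*-Solver)
  open +-*-Solver

count-cong : ∀ k {P Q : Bits k → Bool} → (∀ x → P x ≡ Q x) → count k P ≡ count k Q
count-cong k P≗Q = cong sum (map-cong (λ x → cong (λ c → if c then 1 else 0) (P≗Q x)) (allBits k))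

count-∨ : ∀ k (P Q : Bits k → Bool) → (∀ x → P x ∧ Q x ≡ false) →
          count k (λ x → P x ∨ Q x) ≡ count k P ℕ.+ count k Q
count-∨ k P Q disjoint = go (allBits k)
  where
  indicator : Bool → ℕ
  indicator c = if c then 1 else 0

  indicator-∨ : ∀ p q → p ∧ q ≡ false → indicator (p ∨ q) ≡ indicator p ℕ.+ indicator q
  indicator-∨ true  false _ = refl
  indicator-∨ false _     _ = refl

  go : ∀ xs → sum (List.map (λ x → indicator (P x ∨ Q x)) xs)
            ≡ sum (List.map (indicator ∘ P) xs) ℕ.+ sum (List.map (indicator ∘ Q) xs)
  go List.[]       = refl
  go (x List.∷ xs) = begin
    indicator (P x ∨ Q x) ℕ.+ sum (List.map (λ x → indicator (P x ∨ Q x)) xs)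
      ≡⟨ cong₂ ℕ._+_ (indicator-∨ (P x) (Q x) (disjoint x)) (go xs) ⟩
    (indicator (P x) ℕ.+ indicator (Q x)) ℕ.+ (p ℕ.+ q)
      ≡⟨ +-interchange (indicator (P x)) (indicator (Q x)) p q ⟩
    (indicator (P x) ℕ.+ p) ℕ.+ (indicator (Q x) ℕ.+ q) ∎
    where
    open ≡-Reasoning
    p = sum (List.map (indicator ∘ P) xs)
    q = sum (List.map (indicator ∘ Q) xs)

length-allBits : ∀ k → List.length (allBits k) ≡ 2 ℕ.^ k
length-allBits zero    = refl
length-allBits (suc k) = begin
  List.length (List.map (true ∷_) (allBits k) List.++ List.map (false ∷_) (allBits k))
    ≡⟨ length-++ (List.map (true ∷_) (allBits k)) ⟩
  List.length (List.map (true ∷_) (allBits k)) ℕ.+ List.length (List.map (false ∷_) (allBits k))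
    ≡⟨ cong₂ ℕ._+_ (length-map (true ∷_) (allBits k)) (length-map (false ∷_) (allBits k)) ⟩
  List.length (allBits k) ℕ.+ List.length (allBits k)
    ≡⟨ cong (λ l → l ℕ.+ l) (length-allBits k) ⟩
  2 ℕ.^ k ℕ.+ 2 ℕ.^ k
    ≡⟨ cong (2 ℕ.^ k ℕ.+_) (sym (ℕ.+-identityʳ _)) ⟩
  2 ℕ.^ suc k ∎
  where open ≡-Reasoning

count-true : ∀ k → count k (λ _ → true) ≡ 2 ℕ.^ k
count-true k = trans (sum-map-1 (allBits k)) (length-allBits k)
  where
  sum-map-1 : ∀ {A : Set} (xs : List A) → sum (List.map (λ _ → 1) xs) ≡ List.length xs
  sum-map-1 List.[]       = refl
  sum-map-1 (_ List.∷ xs) = cong suc (sum-map-1 xs)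

Pr-cong : ∀ k {P Q : Bits k → Bool} → (∀ x → P x ≡ Q x) → Pr k P ≡ Pr k Q
Pr-cong k P≗Q = cong (λ c → (+ c) / 2 ℕ.^ k) (count-cong k P≗Q)
  where instance _ = ℕ.m^n≢0 2 k

Pr-∨ : ∀ k (P Q : Bits k → Bool) → (∀ x → P x ∧ Q x ≡ false) →
       Pr k (λ x → P x ∨ Q x) ≡ Pr k P + Pr k Q
Pr-∨ k P Q disjoint = trans
  (cong (λ c → (+ c) / 2 ℕ.^ k) (count-∨ k P Q disjoint))
  (sym (a/d+b/d≡[a+b]/d (count k P) (count k Q) (2 ℕ.^ k)))
  where instance _ = ℕ.m^n≢0 2 k

Pr-true : ∀ k → Pr k (λ _ → true) ≡ 1ℚ
Pr-true k = trans (cong (λ c → (+ c) / 2 ℕ.^ k) (count-true k)) (d/d≡1 (2 ℕ.^ k))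
  where instance _ = ℕ.m^n≢0 2 k

Pr-beq : ∀ k (P Q : Bits k → Bool) →
         Pr k (λ x → beq (P x) (Q x)) ≡ Pr k (λ x → not (P x) ∧ not (Q x)) + Pr k (λ x → P x ∧ Q x)
Pr-beq k P Q = trans (Pr-cong k (λ x → split (P x) (Q x))) (Pr-∨ k _ _ (λ x → disjoint (P x) (Q x)))
  where
  split : ∀ p q → beq p q ≡ (not p ∧ not q) ∨ (p ∧ q)
  split true  true  = refl
  split true  false = refl
  split false true  = refl
  split false false = refl

  disjoint : ∀ p q → (not p ∧ not q) ∧ (p ∧ q) ≡ false
  disjoint true  _     = refl
  disjoint false true  = refl
  disjoint false false = refl

Pr-not : ∀ k (P : Bits k → Bool) → Pr k P + Pr k (not ∘ P) ≡ 1ℚ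
Pr-not k P = trans (sym (Pr-∨ k P (not ∘ P) (λ x → disjoint (P x))))
                   (trans (Pr-cong k (λ x → excluded-middle (P x))) (Pr-true k))
  where
  disjoint : ∀ p → p ∧ not p ≡ false
  disjoint true  = refl
  disjoint false = refl

  excluded-middle : ∀ p → p ∨ not p ≡ true
  excluded-middle true  = refl
  excluded-middle false = refl

evalPoly-map-* : ∀ c p n → evalPoly (List.map (c ℕ.*_) p) n ≡ c ℕ.* evalPoly p n
evalPoly-map-* c List.[]       n = sym (ℕ.*-zeroʳ c)
evalPoly-map-* c (a List.∷ p) n = begin
  c ℕ.* a ℕ.+ n ℕ.* evalPoly (List.map (c ℕ.*_) p) n   ≡⟨ cong (λ e → c ℕ.* a ℕ.+ n ℕ.* e) (evalPoly-map-* c p n) ⟩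
  c ℕ.* a ℕ.+ n ℕ.* (c ℕ.* evalPoly p n)              ≡⟨ cong (c ℕ.* a ℕ.+_) (*-left-commute n c (evalPoly p n)) ⟩
  c ℕ.* a ℕ.+ c ℕ.* (n ℕ.* evalPoly p n)              ≡⟨ ℕ.*-distribˡ-+ c a _ ⟨
  c ℕ.* (a ℕ.+ n ℕ.* evalPoly p n)                    ∎
  where open ≡-Reasoning

size-subst : ∀ {k k′} (eq : k ≡ k′) (C : OCircuit k) → OCircuit.size (subst OCircuit eq C) ≡ OCircuit.size C
size-subst refl C = refl

runC-subst : ∀ {k k′} (eq : k ≡ k′) (C : OCircuit k) (z : Bits k′) →
             runC (subst OCircuit eq C) z ≡ runC C (cast (sym eq) z)
runC-subst refl C z = cong (runC C) (sym (cast-is-id refl z))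

PPoly⇒NPoly : ∀ {ℓ} → PPoly ℓ → NPoly ℓ
PPoly⇒NPoly {ℓ} A = record
  { bound  = PPoly.bound A
  ; witLen = λ _ → 0
  ; circ   = λ n → subst OCircuit (ℓn≡ℓn+0 n) (PPoly.circ A n)
  ; small  = λ n → subst (ℕ._≤ evalPoly (PPoly.bound A) (ℓ n))
                         (sym (size-subst (ℓn≡ℓn+0 n) (PPoly.circ A n))) (PPoly.small A n)
  ; wsmall = λ _ → z≤n
  }
  where
  ℓn≡ℓn+0 : ∀ n → ℓ n ≡ ℓ n ℕ.+ 0
  ℓn≡ℓn+0 n = sym (ℕ.+-identityʳ (ℓ n))

module _ {ℓ} (A : PPoly ℓ) (n : ℕ) (y : Bits (ℓ n)) where

  runC-PPoly⇒NPoly : runC (NPoly.circ (PPoly⇒NPoly A) n) (y ++ []) ≡ runP A n y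
  runC-PPoly⇒NPoly = trans (runC-subst (sym (ℕ.+-identityʳ (ℓ n))) (PPoly.circ A n) (y ++ []))
                           (cong (runC (PPoly.circ A n)) (++-identityʳ-eqFree y))

  runNP-PPoly⇒NPoly : runNP (PPoly⇒NPoly A) n y ≡ runP A n y
  runNP-PPoly⇒NPoly = trans (∨-identityʳ _) runC-PPoly⇒NPoly

  runCoNP-PPoly⇒NPoly : runCoNP (PPoly⇒NPoly A) n y ≡ runP A n y
  runCoNP-PPoly⇒NPoly = trans (∧-identityʳ _) runC-PPoly⇒NPoly

InfinitelyMany-⊎ : ∀ {P Q R : ℕ → Set} → (∀ n → P n → Q n ⊎ R n) →
                   InfinitelyMany P → ¬ InfinitelyMany Q → InfinitelyMany R
InfinitelyMany-⊎ P⇒Q⊎R often-P ¬often-Q (N , ¬R) = ¬often-Q λ (M , ¬Q) →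
  often-P (M ⊔ N , λ n M⊔N≤n Pn →
    [ ¬Q n (ℕ.m⊔n≤o⇒m≤o M N M⊔N≤n) , ¬R n (ℕ.m⊔n≤o⇒n≤o M N M⊔N≤n) ] (P⇒Q⊎R n Pn))

module _ (m : ℕ → ℕ) (f : Fun m) (b : Pred) where

  Predicts : PPoly (advLen m) → Poly → ℕ → Set
  Predicts A p n =
    (0 ℕ.< evalPoly p n) ×
    (½ + frac 1 (evalPoly p n) ≤ Pr n (λ x → beq (runP A n (f n x ++ ones n)) (b n x)))

  BreaksNP : NPoly (advLen m) → Poly → ℕ → Set
  BreaksNP A₁ p n =
    (0 ℕ.< evalPoly p n) ×
    (½ + frac 1 (evalPoly p n) ≤
       Pr n (λ x → not (runNP A₁ n (f n x ++ ones n)) ∧ not (b n x))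
       + ½ * Pr (m n) (λ y → runNP A₁ n (y ++ ones n)))

  BreaksCoNP : NPoly (advLen m) → Poly → ℕ → Set
  BreaksCoNP A₂ p n =
    (0 ℕ.< evalPoly p n) ×
    (½ + frac 1 (evalPoly p n) ≤
       Pr n (λ x → runCoNP A₂ n (f n x ++ ones n) ∧ b n x)
       + ½ * Pr (m n) (λ y → not (runCoNP A₂ n (y ++ ones n))))

  module _ (A : PPoly (advLen m)) (n : ℕ) where
    private
      B : NPoly (advLen m)
      B = PPoly⇒NPoly A

      a : Bits (m n) → Bool
      a y = runP A n (y ++ ones n)

    Pr-agree₀ Pr-agree₁ Pr-accept Pr-reject : ℚ
    Pr-agree₀ = Pr n (λ x → not (runNP B n (f n x ++ ones n)) ∧ not (b n x))
    Pr-agree₁ = Pr n (λ x → runCoNP B n (f n x ++ ones n) ∧ b n x)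
    Pr-accept = Pr (m n) (λ y → runNP B n (y ++ ones n))
    Pr-reject = Pr (m n) (λ y → not (runCoNP B n (y ++ ones n)))

    Pr-agree≡Pr-agree₀+Pr-agree₁ : Pr n (λ x → beq (a (f n x)) (b n x)) ≡ Pr-agree₀ + Pr-agree₁
    Pr-agree≡Pr-agree₀+Pr-agree₁ = trans (Pr-beq n (a ∘ f n) (b n)) (cong₂ _+_
      (Pr-cong n λ x → cong (λ c → not c ∧ not (b n x)) (sym (runNP-PPoly⇒NPoly A n _)))
      (Pr-cong n λ x → cong (_∧ b n x) (sym (runCoNP-PPoly⇒NPoly A n _))))

    Pr-accept+Pr-reject≡1 : Pr-accept + Pr-reject ≡ 1ℚ
    Pr-accept+Pr-reject≡1 = trans (cong₂ _+_
      (Pr-cong (m n) λ y → runNP-PPoly⇒NPoly A n _)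
      (Pr-cong (m n) λ y → cong not (runCoNP-PPoly⇒NPoly A n _))) (Pr-not (m n) a)

  Predicts⇒Breaks : ∀ A p n → Predicts A p n →
                    BreaksNP (PPoly⇒NPoly A) (List.map (2 ℕ.*_) p) n ⊎
                    BreaksCoNP (PPoly⇒NPoly A) (List.map (2 ℕ.*_) p) n
  Predicts⇒Breaks A p n (p>0 , ½+e≤success) =
    Sum.map (λ h → 2p>0 , halve h) (λ h → 2p>0 , halve h)
      (½+e≤u+v⇒halves (Pr-agree₀ A n) (Pr-agree₁ A n) (Pr-accept A n) (Pr-reject A n)
        (frac 1 (evalPoly p n)) (Pr-accept+Pr-reject≡1 A n)
        (subst (½ + frac 1 (evalPoly p n) ≤_) (Pr-agree≡Pr-agree₀+Pr-agree₁ A n) ½+e≤success))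
    where
    2p>0 : 0 ℕ.< evalPoly (List.map (2 ℕ.*_) p) n
    2p>0 = subst (0 ℕ.<_) (sym (evalPoly-map-* 2 p n)) (ℕ.*-monoʳ-< 2 p>0)

    frac-2p : frac 1 (evalPoly (List.map (2 ℕ.*_) p) n) ≡ ½ * frac 1 (evalPoly p n)
    frac-2p = trans (cong (frac 1) (evalPoly-map-* 2 p n)) (frac-1-* 2 (evalPoly p n))

    halve : ∀ {r} → ½ + ½ * frac 1 (evalPoly p n) ≤ r → ½ + frac 1 (evalPoly (List.map (2 ℕ.*_) p) n) ≤ r
    halve {r} = subst (λ e → ½ + e ≤ r) (sym frac-2p)

lemma6p8 : (m : ℕ → ℕ) (f : Fun m) (b : Pred) → SuperCore m f b → HardCore m f b
lemma6p8 m f b (b∈P , ¬breaksNP , ¬breaksCoNP) = b∈P , λ (A , p , often) →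
  ¬breaksCoNP (PPoly⇒NPoly A , List.map (2 ℕ.*_) p ,
    InfinitelyMany-⊎ (Predicts⇒Breaks m f b A p) often
      λ often-NP → ¬breaksNP (PPoly⇒NPoly A , List.map (2 ℕ.*_) p , often-NP))
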